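{- Let $m \geq 3$. Let $G$ be the graph with vertex set $\mathbb{Z}_m\times\mathbb{Z}_8$ whose edges are: all edges of the Cayley graph $\mathrm{Cay}(\mathbb{Z}_m\times\mathbb{Z}_8,\{(1,4),(-1,4)\})$ (i.e. $\{(i,x),(i\pm1,x+4)\}$), together with all edges $\{(i,x),(i,y)\}$ with $i\in\mathbb{Z}_m$ and $x\neq y\in\mathbb{Z}_8$ (so that each set $\{i\}\times\mathbb{Z}_8$ induces a complete graph $K_8$). Then the edge set of $G$ can be partitioned into four $C_8$-factors and one 1-factor.
   Context: For a finite additive group $\Gamma$ and $S\subseteq\Gamma\setminus\{0\}$ with $S=-S$, $\mathrm{Cay}(\Gamma,S)$ has vertex set $\Gamma$ and edges $\{x,y\}$ with $x-y\in S$. A $C_k$-factor of a graph is a spanning subgraph each of whose components is a cycle of length $k$; a 1-factor is a perfect matching. -}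

module Defs where

open import Data.Nat using (ℕ; zero; suc; _+_; _%_; NonZero)
open import Data.Nat.DivMod using (m%n<n)
open import Data.Fin using (Fin; toℕ; fromℕ<)
open import Data.Product using (_×_; Σ; ∃; _,_)
open import Data.Sum using (_⊎_)
open import Relation.Binary.PropositionalEquality using (_≡_)
open import Relation.Nullary using (¬_)
open import Function.Definitions using (Injective)

nextMod : (k : ℕ) → .{{_ : NonZero k}} → Fin k → Fin k
nextMod k i = fromℕ< (m%n<n (suc (toℕ i)) k)

-- A (simple, undirected) graph on a vertex type V is given by a
-- (symmetric) adjacency relation.  Spanning subgraphs are relations H on V.

-- H contains a k-cycle through the injective vertex sequence f, and this
-- cycle is a whole component of H: every H-edge at a vertex f i goes to
-- f (i+1) or f (i-1).
IsComponentCycle : {V : Set} (H : V → V → Set) (k : ℕ) .{{_ : NonZero k}}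
                   → (Fin k → V) → Set
IsComponentCycle {V} H k f =
  Injective _≡_ _≡_ f
  × (∀ i → H (f i) (f (nextMod k i)))
  × (∀ i (w : V) → H (f i) w →
       Σ (Fin k) λ j → (w ≡ f j) × ((j ≡ nextMod k i) ⊎ (i ≡ nextMod k j)))

IsCkFactor : {V : Set} (k : ℕ) .{{_ : NonZero k}} (H : V → V → Set) → Set
IsCkFactor {V} k H =
  ∀ (v : V) → Σ (Fin k → V) λ f → IsComponentCycle H k f × (Σ (Fin k) λ i → f i ≡ v)

Is1Factor : {V : Set} (H : V → V → Set) → Set
Is1Factor {V} H = ∀ (u : V) → Σ V λ v → H u v × (∀ w → H u w → w ≡ v)

Vtx : ℕ → Set
Vtx m = Fin m × Fin 8

-- Edges of Cay(ℤ_m × ℤ_8, {(1,4),(-1,4)}):  (i,x) ~ (j,y) iff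
-- j = i ± 1 (mod m) and y = x + 4 (mod 8)  (note 4 = -4 mod 8).
CayAdj : (m : ℕ) .{{_ : NonZero m}} → Vtx m → Vtx m → Set
CayAdj m (i , x) (j , y) =
  ((toℕ j ≡ (toℕ i + 1) % m) ⊎ (toℕ i ≡ (toℕ j + 1) % m))
  × (toℕ y ≡ (toℕ x + 4) % 8)

FibreAdj : (m : ℕ) → Vtx m → Vtx m → Set
FibreAdj m (i , x) (j , y) = (i ≡ j) × ¬ (x ≡ y)

GAdj : (m : ℕ) .{{_ : NonZero m}} → Vtx m → Vtx m → Set
GAdj m u v = CayAdj m u v ⊎ FibreAdj m u v

-- An edge partition of G into 5 classes, given by a colouring of the edges
-- (col u v is only relevant when u ~ v, and must be symmetric there).
ColourClass : (m : ℕ) .{{_ : NonZero m}} → (Vtx m → Vtx m → Fin 5) → Fin 5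
              → Vtx m → Vtx m → Set
ColourClass m col c u v = GAdj m u v × (col u v ≡ c)

module Submission where

-- In every fibre {i} × ℤ₈ the K₈ splits into the two Hamiltonian cycles
-- 04152637 (colour 2) and 05342716 (colour 3) and three perfect matchings:
-- {02,13,46,57} (colour 4), {03,12,45,67} (colour 0) and {01,23,47,56}
-- (colour 1).  The Cayley edge from (i,x) to (i+1,x+4) gets colour 0 if
-- x < 4 and colour 1 otherwise; with the colour-0 fibre edges it closes up
-- into the 8-cycles (i,0)(i+1,4)(i+1,5)(i,1)(i,2)(i+1,6)(i+1,7)(i,3), and
-- symmetrically for colour 1.  So every colour class consists of translates
-- of one pattern inside two consecutive fibres.  As m ≥ 3, the fibres i-1,
-- i, i+1 are distinct, so every vertex sees the same neighbourhood from any
-- such window, and all the checks become finite computations on ℤ₂ × ℤ₈.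

open import Defs
open import Data.Nat using (ℕ; _≤_; NonZero; suc; _+_; _*_; _/_; _%_; _<_; s≤s; z≤n)
open import Data.Fin using (Fin; zero; suc; toℕ; fromℕ<)
open import Data.Product using (Σ; _×_; _,_; proj₁; proj₂)
open import Relation.Binary.PropositionalEquality
  using (_≡_; _≢_; refl; sym; trans; cong; cong₂; subst; module ≡-Reasoning)

open import Data.Nat.Properties using (+-comm; +-suc; +-cancelˡ-≡; <⇒≱; <⇒≤)
open import Data.Nat.DivMod using (m%n<n; m≡m%n+[m/n]*n; %-distribˡ-+; m%n%n≡m%n; [m+n]%n≡m%n; m<n⇒m%n≡m)
open import Data.Nat.Divisibility using (divides; ∣⇒≤)
open import Data.Fin.Patterns using (0F; 1F; 2F; 3F; 4F; 5F; 6F; 7F)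
open import Data.Fin.Properties using (toℕ-fromℕ<; toℕ-injective; toℕ<n; _≟_; all?; any?)
open import Data.Vec using (Vec; []; _∷_; lookup)
open import Data.Maybe using (Maybe; just; nothing)
import Data.Maybe.Properties as Maybe
import Data.Product.Properties as Product
open import Data.Sum using (_⊎_; inj₁; inj₂)
open import Data.Unit using (⊤; tt)
open import Data.Empty using (⊥-elim)
open import Function using (_∘_)
open import Function.Definitions using (Injective)
open import Relation.Nullary using (Dec; yes; no)
open import Relation.Nullary.Decidable using (map′; toWitness; ¬?; _×-dec_; _⊎-dec_; _→-dec_)

open ≡-Reasoning

[m+n%d]%d≡[m+n]%d : ∀ m n d .{{_ : NonZero d}} → (m + n % d) % d ≡ (m + n) % d
[m+n%d]%d≡[m+n]%d m n d = begin
  (m + n % d) % d         ≡⟨ %-distribˡ-+ m (n % d) d ⟩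
  (m % d + n % d % d) % d ≡⟨ cong (λ t → (m % d + t) % d) (m%n%n≡m%n n d) ⟩
  (m % d + n % d) % d     ≡⟨ %-distribˡ-+ m n d ⟨
  (m + n) % d             ∎

[n+m]%n≡m : ∀ {m} n .{{_ : NonZero n}} → m < n → (n + m) % n ≡ m
[n+m]%n≡m {m} n m<n = begin
  (n + m) % n ≡⟨ cong (_% n) (+-comm n m) ⟩
  (m + n) % n ≡⟨ [m+n]%n≡m%n m n ⟩
  m % n       ≡⟨ m<n⇒m%n≡m m<n ⟩
  m           ∎

[m+d]%n≢m : ∀ {m d n} .{{_ : NonZero n}} .{{_ : NonZero d}} → d < n → (m + d) % n ≢ m
[m+d]%n≢m {m} {d} {n} d<n eq = <⇒≱ d<n (∣⇒≤ (divides ((m + d) / n) d≡q*n))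
  where
  d≡q*n : d ≡ (m + d) / n * n
  d≡q*n = +-cancelˡ-≡ m d ((m + d) / n * n) (begin
    m + d                         ≡⟨ m≡m%n+[m/n]*n (m + d) n ⟩
    (m + d) % n + (m + d) / n * n ≡⟨ cong (_+ (m + d) / n * n) eq ⟩
    m + (m + d) / n * n           ∎)

toℕ-nextMod : ∀ k .{{_ : NonZero k}} (i : Fin k) → toℕ (nextMod k i) ≡ suc (toℕ i) % k
toℕ-nextMod k i = toℕ-fromℕ< _

module _ {n : ℕ} where

  prevMod : Fin (suc n) → Fin (suc n)
  prevMod i = fromℕ< (m%n<n (n + toℕ i) (suc n))

  prevMod-nextMod : ∀ i → prevMod (nextMod (suc n) i) ≡ i
  prevMod-nextMod i = toℕ-injective (begin
    toℕ (prevMod (nextMod (suc n) i))     ≡⟨ toℕ-fromℕ< _ ⟩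
    (n + toℕ (nextMod (suc n) i)) % suc n ≡⟨ cong (λ t → (n + t) % suc n) (toℕ-nextMod (suc n) i) ⟩
    (n + suc (toℕ i) % suc n) % suc n     ≡⟨ [m+n%d]%d≡[m+n]%d n (suc (toℕ i)) (suc n) ⟩
    (n + suc (toℕ i)) % suc n             ≡⟨ cong (_% suc n) (+-suc n (toℕ i)) ⟩
    (suc n + toℕ i) % suc n               ≡⟨ [n+m]%n≡m (suc n) (toℕ<n i) ⟩
    toℕ i                                 ∎)

  nextMod-prevMod : ∀ i → nextMod (suc n) (prevMod i) ≡ i
  nextMod-prevMod i = toℕ-injective (begin
    toℕ (nextMod (suc n) (prevMod i)) ≡⟨ toℕ-nextMod (suc n) (prevMod i) ⟩
    suc (toℕ (prevMod i)) % suc n     ≡⟨ cong (λ t → suc t % suc n) (toℕ-fromℕ< _) ⟩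
    (1 + (n + toℕ i) % suc n) % suc n ≡⟨ [m+n%d]%d≡[m+n]%d 1 (n + toℕ i) (suc n) ⟩
    (suc n + toℕ i) % suc n           ≡⟨ [n+m]%n≡m (suc n) (toℕ<n i) ⟩
    toℕ i                             ∎)

  nextMod-≢ : 2 ≤ suc n → ∀ i → nextMod (suc n) i ≢ i
  nextMod-≢ (s≤s (s≤s _)) i eq = [m+d]%n≢m (s≤s (s≤s z≤n)) (begin
    (toℕ i + 1) % suc n           ≡⟨ cong (_% suc n) (+-comm (toℕ i) 1) ⟩
    suc (toℕ i) % suc n           ≡⟨ toℕ-nextMod (suc n) i ⟨
    toℕ (nextMod (suc n) i)       ≡⟨ cong toℕ eq ⟩
    toℕ i                         ∎)

  nextMod²-≢ : 3 ≤ suc n → ∀ i → nextMod (suc n) (nextMod (suc n) i) ≢ i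
  nextMod²-≢ (s≤s (s≤s (s≤s _))) i eq = [m+d]%n≢m (s≤s (s≤s (s≤s z≤n))) (begin
    (toℕ i + 2) % suc n                       ≡⟨ cong (_% suc n) (+-comm (toℕ i) 2) ⟩
    (1 + suc (toℕ i)) % suc n                 ≡⟨ [m+n%d]%d≡[m+n]%d 1 (suc (toℕ i)) (suc n) ⟨
    (1 + suc (toℕ i) % suc n) % suc n         ≡⟨ cong (λ t → (1 + t) % suc n) (toℕ-nextMod (suc n) i) ⟨
    (1 + toℕ (nextMod (suc n) i)) % suc n     ≡⟨ toℕ-nextMod (suc n) (nextMod (suc n) i) ⟨
    toℕ (nextMod (suc n) (nextMod (suc n) i)) ≡⟨ cong toℕ eq ⟩
    toℕ i                                     ∎)

  prevMod-≢ : 2 ≤ suc n → ∀ i → prevMod i ≢ i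
  prevMod-≢ 2≤k i eq = nextMod-≢ 2≤k i (trans (cong (nextMod (suc n)) (sym eq)) (nextMod-prevMod i))

  prevMod-≢-nextMod : 3 ≤ suc n → ∀ i → prevMod i ≢ nextMod (suc n) i
  prevMod-≢-nextMod 3≤k i eq =
    nextMod²-≢ 3≤k i (trans (cong (nextMod (suc n)) (sym eq)) (nextMod-prevMod i))

antipode : Fin 8 → Fin 8
antipode x = fromℕ< (m%n<n (toℕ x + 4) 8)

antipode-unique : ∀ x {y} → toℕ y ≡ (toℕ x + 4) % 8 → y ≡ antipode x
antipode-unique x e = toℕ-injective (trans e (sym (toℕ-fromℕ< _)))

fibreColour : Fin 8 → Fin 8 → Fin 5
fibreColour x y = lookup (lookup table x) y
  where
  -- the diagonal entries are junk: x ≢ y on every fibre edge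
  table : Vec (Vec (Fin 5) 8) 8
  table = (0F ∷ 1F ∷ 4F ∷ 0F ∷ 2F ∷ 3F ∷ 3F ∷ 2F ∷ [])
        ∷ (1F ∷ 0F ∷ 0F ∷ 4F ∷ 2F ∷ 2F ∷ 3F ∷ 3F ∷ [])
        ∷ (4F ∷ 0F ∷ 0F ∷ 1F ∷ 3F ∷ 2F ∷ 2F ∷ 3F ∷ [])
        ∷ (0F ∷ 4F ∷ 1F ∷ 0F ∷ 3F ∷ 3F ∷ 2F ∷ 2F ∷ [])
        ∷ (2F ∷ 2F ∷ 3F ∷ 3F ∷ 0F ∷ 0F ∷ 4F ∷ 1F ∷ [])
        ∷ (3F ∷ 2F ∷ 2F ∷ 3F ∷ 0F ∷ 0F ∷ 1F ∷ 4F ∷ [])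
        ∷ (3F ∷ 3F ∷ 2F ∷ 2F ∷ 4F ∷ 1F ∷ 0F ∷ 0F ∷ [])
        ∷ (2F ∷ 3F ∷ 3F ∷ 2F ∷ 1F ∷ 4F ∷ 0F ∷ 0F ∷ [])
        ∷ []

fibreColour-symmetric : ∀ x y → fibreColour x y ≡ fibreColour y x
fibreColour-symmetric = toWitness {a? = all? λ x → all? λ y → fibreColour x y ≟ fibreColour y x} tt

cayleyColour : Fin 8 → Fin 5
cayleyColour = lookup (0F ∷ 0F ∷ 0F ∷ 0F ∷ 1F ∷ 1F ∷ 1F ∷ 1F ∷ [])

data Move : Set where
  within : Fin 8 → Move
  forward backward : Move

NonLoop : Fin 8 → Move → Set
NonLoop x (within y) = x ≢ y
NonLoop x forward = ⊤
NonLoop x backward = ⊤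

nonLoop? : ∀ x mv → Dec (NonLoop x mv)
nonLoop? x (within y) = ¬? (x ≟ y)
nonLoop? x forward = yes tt
nonLoop? x backward = yes tt

moveColour : Fin 8 → Move → Fin 5
moveColour x (within y) = fibreColour x y
moveColour x forward = cayleyColour x
moveColour x backward = cayleyColour (antipode x)

allMove? : {P : Move → Set} → (∀ mv → Dec (P mv)) → Dec (∀ mv → P mv)
allMove? P? = map′
  (λ (w , f , b) → λ { (within y) → w y ; forward → f ; backward → b })
  (λ h → (λ y → h (within y)) , h forward , h backward)
  (all? (P? ∘ within) ×-dec P? forward ×-dec P? backward)

anyMove? : {P : Move → Set} → (∀ mv → Dec (P mv)) → Dec (Σ Move P)
anyMove? P? = map′
  (λ { (inj₁ (y , p)) → within y , p ; (inj₂ (inj₁ p)) → forward , p ; (inj₂ (inj₂ p)) → backward , p })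
  (λ { (within y , p) → inj₁ (y , p) ; (forward , p) → inj₂ (inj₁ p) ; (backward , p) → inj₂ (inj₂ p) })
  (any? (P? ∘ within) ⊎-dec P? forward ⊎-dec P? backward)

-- A position in the window formed by fibres i (layer 0) and i+1 (layer 1).
Loc : Set
Loc = Fin 2 × Fin 8

step : Loc → Move → Maybe Loc
step (l , x) (within y) = just (l , y)
step (0F , x) forward = just (1F , antipode x)
step (1F , x) forward = nothing
step (0F , x) backward = nothing
step (1F , x) backward = just (0F , antipode x)

_≟Loc_ : (p q : Loc) → Dec (p ≡ q)
_≟Loc_ = Product.≡-dec _≟_ _≟_

_≟MaybeLoc_ : (p q : Maybe Loc) → Dec (p ≡ q)
_≟MaybeLoc_ = Maybe.≡-dec _≟Loc_

module _ (c : Fin 5) (g : Fin 8 → Loc) where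

  LocalEdges : Set
  LocalEdges = ∀ k → Σ Move λ mv → let x = proj₂ (g k) in
    NonLoop x mv × step (g k) mv ≡ just (g (nextMod 8 k)) × moveColour x mv ≡ c

  -- Quantifying over moves rather than over window vertices also forces the
  -- edges leaving the window (step = nothing) to avoid colour c.
  LocalClosed : Set
  LocalClosed = ∀ k mv → let x = proj₂ (g k) in NonLoop x mv → moveColour x mv ≡ c →
    Σ (Fin 8) λ j → step (g k) mv ≡ just (g j) × ((j ≡ nextMod 8 k) ⊎ (k ≡ nextMod 8 j))

  IsLocalCycle : Set
  IsLocalCycle = (∀ k l → g k ≡ g l → k ≡ l) × LocalEdges × LocalClosed
               × (∀ x → Σ (Fin 8) λ k → proj₂ (g k) ≡ x)

  isLocalCycle? : Dec IsLocalCycle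
  isLocalCycle? =
    (all? λ k → all? λ l → (g k ≟Loc g l) →-dec (k ≟ l))
    ×-dec (all? λ k → anyMove? λ mv → nonLoop? _ mv
             ×-dec (step (g k) mv ≟MaybeLoc just (g (nextMod 8 k))) ×-dec (moveColour _ mv ≟ c))
    ×-dec (all? λ k → allMove? λ mv → nonLoop? _ mv →-dec (moveColour _ mv ≟ c) →-dec
             any? λ j → (step (g k) mv ≟MaybeLoc just (g j)) ×-dec ((j ≟ nextMod 8 k) ⊎-dec (k ≟ nextMod 8 j)))
    ×-dec (all? λ x → any? λ k → proj₂ (g k) ≟ x)

IsLocalMatching : Fin 5 → (Fin 8 → Fin 8) → Set
IsLocalMatching c partner = ∀ x → NonLoop x (within (partner x)) × fibreColour x (partner x) ≡ c
  × (∀ mv → NonLoop x mv → moveColour x mv ≡ c → step (0F , x) mv ≡ just (0F , partner x))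

isLocalMatching? : ∀ c partner → Dec (IsLocalMatching c partner)
isLocalMatching? c partner = all? λ x → nonLoop? x (within (partner x)) ×-dec (fibreColour x (partner x) ≟ c)
  ×-dec allMove? λ mv → nonLoop? x mv →-dec (moveColour x mv ≟ c) →-dec (step (0F , x) mv ≟MaybeLoc just (0F , partner x))

cycle₀ : IsLocalCycle 0F (lookup ((0F , 0F) ∷ (1F , 4F) ∷ (1F , 5F) ∷ (0F , 1F) ∷ (0F , 2F) ∷ (1F , 6F) ∷ (1F , 7F) ∷ (0F , 3F) ∷ []))
cycle₀ = toWitness {a? = isLocalCycle? _ _} tt

cycle₁ : IsLocalCycle 1F (lookup ((0F , 4F) ∷ (1F , 0F) ∷ (1F , 1F) ∷ (0F , 5F) ∷ (0F , 6F) ∷ (1F , 2F) ∷ (1F , 3F) ∷ (0F , 7F) ∷ []))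
cycle₁ = toWitness {a? = isLocalCycle? _ _} tt

cycle₂ : IsLocalCycle 2F (lookup ((0F , 0F) ∷ (0F , 4F) ∷ (0F , 1F) ∷ (0F , 5F) ∷ (0F , 2F) ∷ (0F , 6F) ∷ (0F , 3F) ∷ (0F , 7F) ∷ []))
cycle₂ = toWitness {a? = isLocalCycle? _ _} tt

cycle₃ : IsLocalCycle 3F (lookup ((0F , 0F) ∷ (0F , 5F) ∷ (0F , 3F) ∷ (0F , 4F) ∷ (0F , 2F) ∷ (0F , 7F) ∷ (0F , 1F) ∷ (0F , 6F) ∷ []))
cycle₃ = toWitness {a? = isLocalCycle? _ _} tt

matching₄ : IsLocalMatching 4F (lookup (2F ∷ 3F ∷ 0F ∷ 1F ∷ 6F ∷ 7F ∷ 4F ∷ 5F ∷ []))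
matching₄ = toWitness {a? = isLocalMatching? _ _} tt

module Decomposition {n : ℕ} (3≤m : 3 ≤ suc n) where

  m : ℕ
  m = suc n

  V : Set
  V = Vtx m

  next prev : Fin m → Fin m
  next = nextMod m
  prev = prevMod

  next-≢ : ∀ i → next i ≢ i
  next-≢ = nextMod-≢ (<⇒≤ 3≤m)

  target : V → Move → V
  target (i , x) (within y) = (i , y)
  target (i , x) forward = (next i , antipode x)
  target (i , x) backward = (prev i , antipode x)

  toℕ-next : ∀ i → toℕ (next i) ≡ (toℕ i + 1) % m
  toℕ-next i = trans (toℕ-nextMod m i) (cong (_% m) (+-comm 1 (toℕ i)))

  target-adjacent : ∀ {u} mv → NonLoop (proj₂ u) mv → GAdj m u (target u mv)
  target-adjacent (within y) x≢y = inj₂ (refl , x≢y)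
  target-adjacent {i , x} forward _ = inj₁ (inj₁ (toℕ-next i) , toℕ-fromℕ< _)
  target-adjacent {i , x} backward _ =
    inj₁ (inj₂ (trans (cong toℕ (sym (nextMod-prevMod i))) (toℕ-next (prev i))) , toℕ-fromℕ< _)

  adjacent-target : ∀ {u w} → GAdj m u w → Σ Move λ mv → NonLoop (proj₂ u) mv × w ≡ target u mv
  adjacent-target {i , x} {j , y} (inj₂ (refl , x≢y)) = within y , x≢y , refl
  adjacent-target {i , x} {j , y} (inj₁ (inj₁ j≡i+1 , y≡x+4)) =
    forward , tt , cong₂ _,_ (toℕ-injective (trans j≡i+1 (sym (toℕ-next i)))) (antipode-unique x y≡x+4)
  adjacent-target {i , x} {j , y} (inj₁ (inj₂ i≡j+1 , y≡x+4)) =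
    backward , tt , cong₂ _,_ j≡prev-i (antipode-unique x y≡x+4)
    where j≡prev-i : j ≡ prev i
          j≡prev-i = begin
            j              ≡⟨ prevMod-nextMod j ⟨
            prev (next j)  ≡⟨ cong prev (toℕ-injective (trans (toℕ-next j) (sym i≡j+1))) ⟩
            prev i         ∎

  colour : V → V → Fin 5
  colour (i , x) (j , y) with i ≟ j | j ≟ next i
  ... | yes _ | _     = fibreColour x y
  ... | no _  | yes _ = cayleyColour x
  ... | no _  | no _  = cayleyColour y

  colour-within : ∀ i x y → colour (i , x) (i , y) ≡ fibreColour x y
  colour-within i x y with i ≟ i | i ≟ next i
  ... | yes _   | _ = refl
  ... | no i≢i  | _ = ⊥-elim (i≢i refl)

  colour-forward : ∀ i x y → colour (i , x) (next i , y) ≡ cayleyColour x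
  colour-forward i x y with i ≟ next i | next i ≟ next i
  ... | yes i≡next-i | _     = ⊥-elim (next-≢ i (sym i≡next-i))
  ... | no _         | yes _ = refl
  ... | no _         | no ≢  = ⊥-elim (≢ refl)

  colour-backward : ∀ i x y → colour (i , x) (prev i , y) ≡ cayleyColour y
  colour-backward i x y with i ≟ prev i | prev i ≟ next i
  ... | yes i≡prev-i | _             = ⊥-elim (prevMod-≢ (<⇒≤ 3≤m) i (sym i≡prev-i))
  ... | no _         | yes prev≡next = ⊥-elim (prevMod-≢-nextMod 3≤m i prev≡next)
  ... | no _         | no _          = refl

  colour-target : ∀ u mv → colour u (target u mv) ≡ moveColour (proj₂ u) mv
  colour-target (i , x) (within y) = colour-within i x y
  colour-target (i , x) forward = colour-forward i x (antipode x)
  colour-target (i , x) backward = colour-backward i x (antipode x)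

  colour-symmetric : ∀ u w → GAdj m u w → colour u w ≡ colour w u
  colour-symmetric (i , x) w adj with adjacent-target adj
  ... | within y , _ , refl = begin
    colour (i , x) (i , y) ≡⟨ colour-within i x y ⟩
    fibreColour x y        ≡⟨ fibreColour-symmetric x y ⟩
    fibreColour y x        ≡⟨ colour-within i y x ⟨
    colour (i , y) (i , x) ∎
  ... | forward , _ , refl = begin
    colour (i , x) (next i , antipode x)             ≡⟨ colour-forward i x (antipode x) ⟩
    cayleyColour x                                   ≡⟨ colour-backward (next i) (antipode x) x ⟨
    colour (next i , antipode x) (prev (next i) , x) ≡⟨ cong (λ j → colour (next i , antipode x) (j , x)) (prevMod-nextMod i) ⟩
    colour (next i , antipode x) (i , x)             ∎
  ... | backward , _ , refl = begin
    colour (i , x) (prev i , antipode x)             ≡⟨ colour-backward i x (antipode x) ⟩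
    cayleyColour (antipode x)                        ≡⟨ colour-forward (prev i) (antipode x) x ⟨
    colour (prev i , antipode x) (next (prev i) , x) ≡⟨ cong (λ j → colour (prev i , antipode x) (j , x)) (nextMod-prevMod i) ⟩
    colour (prev i , antipode x) (i , x)             ∎

  layer : Fin m → Fin 2 → Fin m
  layer i 0F = i
  layer i 1F = next i

  embed : Fin m → Loc → V
  embed i p = (layer i (proj₁ p) , proj₂ p)

  embed-injective : ∀ i {p q} → embed i p ≡ embed i q → p ≡ q
  embed-injective i {l , x} {l′ , x′} e = cong₂ _,_ (layer-injective l l′ (cong proj₁ e)) (cong proj₂ e)
    where
    layer-injective : ∀ l l′ → layer i l ≡ layer i l′ → l ≡ l′
    layer-injective 0F 0F _ = refl
    layer-injective 0F 1F e = ⊥-elim (next-≢ i (sym e))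
    layer-injective 1F 0F e = ⊥-elim (next-≢ i e)
    layer-injective 1F 1F _ = refl

  embed-surjective : ∀ p j → Σ (Fin m) λ i → embed i p ≡ (j , proj₂ p)
  embed-surjective (0F , x) j = j , refl
  embed-surjective (1F , x) j = prev j , cong (_, x) (nextMod-prevMod j)

  step-target : ∀ i p mv {q} → step p mv ≡ just q → target (embed i p) mv ≡ embed i q
  step-target i (l , x) (within y) refl = refl
  step-target i (0F , x) forward refl = refl
  step-target i (1F , x) backward refl = cong (_, antipode x) (prevMod-nextMod i)
  step-target i (1F , x) forward ()
  step-target i (0F , x) backward ()

  module _ {c : Fin 5} {g : Fin 8 → Loc} where

    component-cycle : IsLocalCycle c g → ∀ i → IsComponentCycle (ColourClass m colour c) 8 (embed i ∘ g)
    component-cycle (injective , edges , closed , _) i = injective′ , edges′ , closed′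
      where
      injective′ : Injective _≡_ _≡_ (embed i ∘ g)
      injective′ e = injective _ _ (embed-injective i e)

      edges′ : ∀ k → ColourClass m colour c (embed i (g k)) (embed i (g (nextMod 8 k)))
      edges′ k with edges k
      ... | mv , nonLoop , stepped , coloured =
        subst (ColourClass m colour c (embed i (g k))) (step-target i (g k) mv stepped)
          (target-adjacent mv nonLoop , trans (colour-target (embed i (g k)) mv) coloured)

      closed′ : ∀ k w → ColourClass m colour c (embed i (g k)) w →
        Σ (Fin 8) λ j → (w ≡ embed i (g j)) × ((j ≡ nextMod 8 k) ⊎ (k ≡ nextMod 8 j))
      closed′ k w (adj , coloured) with adjacent-target adj
      ... | mv , nonLoop , refl with closed k mv nonLoop (trans (sym (colour-target (embed i (g k)) mv)) coloured)
      ... | j , stepped , around = j , step-target i (g k) mv stepped , around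

    lift-cycle : IsLocalCycle c g → IsCkFactor 8 (ColourClass m colour c)
    lift-cycle cyc@(_ , _ , _ , covering) (j , x) with covering x
    ... | k , refl with embed-surjective (g k) j
    ... | i , e = embed i ∘ g , component-cycle cyc i , k , e

  lift-matching : ∀ {c partner} → IsLocalMatching c partner → Is1Factor (ColourClass m colour c)
  lift-matching {c} {partner} matching (i , x) with matching x
  ... | nonLoop , coloured , unique = (i , partner x) , matched , only
    where
    matched : ColourClass m colour c (i , x) (i , partner x)
    matched = target-adjacent (within (partner x)) nonLoop , trans (colour-within i x (partner x)) coloured

    only : ∀ w → ColourClass m colour c (i , x) w → w ≡ (i , partner x)
    only w (adj , coloured′) with adjacent-target adj
    ... | mv , nonLoop′ , refl =
      step-target i (0F , x) mv (unique mv nonLoop′ (trans (sym (colour-target (i , x) mv)) coloured′))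

lemma2p14 : (m : ℕ) → {{_ : NonZero m}} → 3 ≤ m →
    Σ (Vtx m → Vtx m → Fin 5) λ col →
      (∀ u v → GAdj m u v → col u v ≡ col v u)
      × IsCkFactor 8 (ColourClass m col zero)
      × IsCkFactor 8 (ColourClass m col (suc zero))
      × IsCkFactor 8 (ColourClass m col (suc (suc zero)))
      × IsCkFactor 8 (ColourClass m col (suc (suc (suc zero))))
      × Is1Factor (ColourClass m col (suc (suc (suc (suc zero)))))
lemma2p14 (suc n) 3≤m =
  colour , colour-symmetric , lift-cycle cycle₀ , lift-cycle cycle₁ , lift-cycle cycle₂ , lift-cycle cycle₃ ,
  lift-matching matching₄
  where open Decomposition 3≤m
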